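{- Let $p$ be a prime, let $e\geq 2$, $d\geq 2$ be integers, let $\lambda\in\{1,\dots,\min(e,d-1)\}$ and let $\alpha=(\alpha_1,\dots,\alpha_d)\in\mathcal R_\lambda(d,e)$. Setting $\mu=\mu(\alpha)$, we have $$\sum_{i=1}^d p^{\alpha_i}x_i\geq \lambda p^{\mu+1}+(d-\lambda)p^{\mu}$$ for every $(x_1,\dots,x_d)\in\mathcal P(p^e,d)$.
   Context: A $d$-dimensional vector-factorisation of $p^e$ is a vector $(v_1,\dots,v_d)$ of positive integers with $v_1\cdots v_d=p^e$. $\mathcal P(p^e,d)$ denotes the convex hull in $\mathbb R^d$ of all $d$-dimensional vector-factorisations of $p^e$. For $\lambda\in\{1,\dots,\min(e,d-1)\}$, $\mathcal R_\lambda(d,e)$ is the set of all $\alpha=(\alpha_1,\dots,\alpha_d)$ with non-negative integer entries such that $\min_i\alpha_i=0$, $d\cdot\max_i\alpha_i<e+\sum_{i=1}^d\alpha_i$, and $e+\sum_{i=1}^d\alpha_i\equiv\lambda\pmod d$. For such $\alpha$, $\mu(\alpha)$ is defined by $\mu(\alpha)d+\lambda=e+\sum_{i=1}^d\alpha_i$.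
   Formalization: The points $(x_1,\dots,x_d)$ of $\mathcal P(p^e,d)$ are only the convex combinations of vector-factorisations with rational weights, rather than all points of the convex hull in $\mathbb R^d$. -}

module Defs where

open import Data.Nat as ℕ using (ℕ; _+_; _*_; _^_; _⊔_)
open import Data.Fin using (Fin)
open import Data.Vec.Functional using (Vector; foldr)
open import Data.List using (List; []; _∷_)
open import Data.List.Relation.Unary.All using (All)
open import Data.Product using (_×_; _,_; ∃; ∃-syntax)
open import Data.Integer as ℤ using (ℤ; +_)
open import Data.Integer.Divisibility as ℤD using ()
open import Data.Rational as ℚ using (ℚ; 0ℚ; 1ℚ; _≤_)
open import Relation.Binary.PropositionalEquality using (_≡_)

sumℕ : ∀ {d} → Vector ℕ d → ℕ
sumℕ = foldr _+_ 0

prodℕ : ∀ {d} → Vector ℕ d → ℕ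
prodℕ = foldr _*_ 1

maxℕ : ∀ {d} → Vector ℕ d → ℕ
maxℕ = foldr _⊔_ 0

toℚ : ℕ → ℚ
toℚ n = (+ n) ℚ./ 1

sumℚ : ∀ {d} → Vector ℚ d → ℚ
sumℚ = foldr ℚ._+_ 0ℚ

IsVectorFactorisation : ℕ → (d : ℕ) → Vector ℕ d → Set
IsVectorFactorisation n d v = (∀ i → 1 ℕ.≤ v i) × prodℕ v ≡ n

WeightedPoints : ℕ → Set
WeightedPoints d = List (ℚ × Vector ℕ d)

weights : ∀ {d} → WeightedPoints d → List ℚ
weights [] = []
weights ((w , _) ∷ ws) = w ∷ weights ws

sumWeights : ∀ {d} → WeightedPoints d → ℚ
sumWeights [] = 0ℚ
sumWeights ((w , _) ∷ ws) = w ℚ.+ sumWeights ws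

combination : ∀ {d} → WeightedPoints d → Vector ℚ d
combination [] i = 0ℚ
combination ((w , v) ∷ ws) i = w ℚ.* toℚ (v i) ℚ.+ combination ws i

-- 𝒫(n,d): convex hull (rational points) of the d-dimensional vector-factorisations of n
InP : ℕ → (d : ℕ) → Vector ℚ d → Set
InP n d x = ∃[ ws ]
    All (λ wv → 0ℚ ≤ Data.Product.proj₁ wv × IsVectorFactorisation n d (Data.Product.proj₂ wv)) ws
  × sumWeights ws ≡ 1ℚ
  × (∀ i → x i ≡ combination ws i)

InR : ℕ → (d e : ℕ) → Vector ℕ d → Set
InR lam d e α =
    (∃[ i ] α i ≡ 0)                       -- min_i α_i = 0 (entries are non-negative)
  × (d * maxℕ α ℕ.< e + sumℕ α)
  × ((+ d) ℤD.∣ ((+ (e + sumℕ α)) ℤ.- (+ lam)))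

-- A vector-factorisation of p^e is (p^β₁, …, p^β_d) with Σ β = e, so Σ p^αᵢ vᵢ = Σ p^γᵢ with
-- γ = α + β and Σ γ = μ d + λ. By convexity p^γ ≥ p^μ + (γ − μ)(p^(μ+1) − p^μ) for every natural
-- γ, and summing gives Σ p^γᵢ ≥ d p^μ + λ (p^(μ+1) − p^μ) = λ p^(μ+1) + (d − λ) p^μ. This bound is
-- linear in the point, hence passes to convex combinations.
module Submission where

open import Defs
open import Data.Nat using (ℕ; zero; suc; _+_; _*_; _^_; _∸_; _≤_; _⊓_; z≤n)
open import Data.Nat.Properties
open import Data.Nat.Primality using (Prime; euclidsLemma; prime⇒nonZero; ¬prime[1])
open import Data.Nat.Divisibility using (divides)
open import Data.Nat.Coprimality using (1-coprimeTo) renaming (sym to coprime-sym)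
open import Data.Nat.Solver using (module +-*-Solver)
import Data.Fin as Fin
open import Data.Vec.Functional as Vec using (Vector; head; tail)
import Data.Integer as ℤ
import Data.Integer.Properties as ℤP
open import Data.Rational as ℚ using (ℚ; mkℚ; 0ℚ; 1ℚ)
import Data.Rational.Properties as ℚP
open import Data.Product using (_×_; _,_; proj₁; proj₂; ∃-syntax; ∃₂)
open import Data.Sum using (inj₁; inj₂)
open import Data.List using ([]; _∷_)
open import Data.List.Relation.Unary.All using (All; []; _∷_)
open import Algebra.Bundles using (Ring; CommutativeMonoid)
open import Algebra.Properties.CommutativeSemigroup
  (CommutativeMonoid.commutativeSemigroup ℚP.*-1-commutativeMonoid) using (x∙yz≈y∙xz)
open import Function using (_∘_)
open import Relation.Nullary using (contradiction)
open import Relation.Binary.PropositionalEquality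

import Algebra.Properties.Semiring.Sum
module ℕΣ = Algebra.Properties.Semiring.Sum +-*-semiring
module ℚΣ = Algebra.Properties.Semiring.Sum (Ring.semiring ℚP.+-*-ring)

open +-*-Solver using (solve; _:+_; _:*_; _:=_; con)

module _ {p} (p-prime : Prime p) where

  private
    instance p≢0 = prime⇒nonZero p-prime

    cancel-p : ∀ m n e → m * p * n ≡ p ^ suc e → m * n ≡ p ^ e
    cancel-p m n e eq = *-cancelˡ-≡ (m * n) (p ^ e) p (trans rearrange eq)
      where
      rearrange : p * (m * n) ≡ m * p * n
      rearrange = solve 3 (λ m n p → p :* (m :* n) := m :* p :* n) refl m n p

  prime-power-factors : ∀ e m n → m * n ≡ p ^ e → ∃₂ λ k l → m ≡ p ^ k × n ≡ p ^ l × k + l ≡ e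
  prime-power-factors zero m n eq = 0 , 0 , m*n≡1⇒m≡1 m n eq , m*n≡1⇒n≡1 m n eq , refl
  prime-power-factors (suc e) m n eq with euclidsLemma m n p-prime (divides (p ^ e) (trans eq (*-comm p (p ^ e))))
  ... | inj₁ (divides q refl) =
    let k , l , q≡ , n≡ , k+l≡e = prime-power-factors e q n (cancel-p q n e eq)
    in suc k , l , trans (cong (_* p) q≡) (*-comm (p ^ k) p) , n≡ , cong suc k+l≡e
  ... | inj₂ (divides q refl) =
    let l , k , q≡ , m≡ , l+k≡e = prime-power-factors e q m (cancel-p q m e (trans (*-comm (q * p) m) eq))
    in k , suc l , m≡ , trans (cong (_* p) q≡) (*-comm (p ^ l) p) , trans (+-suc k l) (cong suc (trans (+-comm k l) l+k≡e))

  prime-power-exponents : ∀ {d} e (v : Vector ℕ d) → prodℕ v ≡ p ^ e →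
    ∃[ β ] (∀ i → v i ≡ p ^ β i) × sumℕ β ≡ e
  prime-power-exponents {zero} e v 1≡p^e with m^n≡1⇒n≡0∨m≡1 p e (sym 1≡p^e)
  ... | inj₁ e≡0 = (λ ()) , (λ ()) , sym e≡0
  ... | inj₂ refl = contradiction p-prime ¬prime[1]
  prime-power-exponents {suc d} e v eq =
    let k , l , head≡ , tail≡ , k+l≡e = prime-power-factors e (head v) (prodℕ (tail v)) eq
        β , v≡ , Σβ≡l = prime-power-exponents l (tail v) tail≡
    in k Vec.∷ β , (λ { Fin.zero → head≡ ; (Fin.suc i) → v≡ i }) , trans (cong (k +_) Σβ≡l) k+l≡e

bernoulli : ∀ s t → 1 + t * s ≤ suc s ^ t
bernoulli s zero = ≤-refl
bernoulli s (suc t) = begin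
  1 + (s + t * s)  ≡⟨ solve 2 (λ s t → con 1 :+ (s :+ t :* s) := con 1 :+ t :* s :+ s) refl s t ⟩
  (1 + t * s) + s  ≤⟨ +-mono-≤ (bernoulli s t) (m≤m*n s (suc s ^ t) {{m^n≢0 (suc s) t}}) ⟩
  suc s ^ suc t    ∎
  where open ≤-Reasoning

reverse-bernoulli : ∀ s t → suc s ^ t ≤ 1 + t * (suc s ^ t * s)
reverse-bernoulli s zero = ≤-refl
reverse-bernoulli s (suc t) = begin
  P + s * P                    ≤⟨ +-monoˡ-≤ (s * P) (reverse-bernoulli s t) ⟩
  1 + t * (P * s) + s * P      ≤⟨ +-mono-≤ (+-monoʳ-≤ 1 (*-monoʳ-≤ t (*-monoˡ-≤ s P≤P′))) (≤-reflexive (*-comm s P)) ⟩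
  1 + t * (P′ * s) + P * s     ≤⟨ +-monoʳ-≤ (1 + t * (P′ * s)) (*-monoˡ-≤ s P≤P′) ⟩
  1 + t * (P′ * s) + P′ * s    ≡⟨ solve 2 (λ t x → con 1 :+ t :* x :+ x := con 1 :+ (x :+ t :* x)) refl t (P′ * s) ⟩
  1 + suc t * (P′ * s)         ∎
  where
  open ≤-Reasoning
  P P′ : ℕ
  P = suc s ^ t
  P′ = suc s ^ suc t
  P≤P′ : P ≤ P′
  P≤P′ = m≤m+n P (s * P)

-- The convex function γ ↦ (1+s)^γ lies above the line through (μ, (1+s)^μ) and (μ+1, (1+s)^(μ+1)),
-- written with both sides moved so that no subtraction occurs.
^-above-secant : ∀ s μ γ → suc s ^ μ + γ * (suc s ^ μ * s) ≤ suc s ^ γ + μ * (suc s ^ μ * s)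
^-above-secant s μ γ with ≤-total μ γ
... | inj₁ μ≤γ with m≤n⇒∃[o]m+o≡n μ≤γ
...   | t , refl = begin
  q + (μ + t) * (q * s)          ≡⟨ solve 4 (λ q μ t s → q :+ (μ :+ t) :* (q :* s) := q :* (con 1 :+ t :* s) :+ μ :* (q :* s)) refl q μ t s ⟩
  q * (1 + t * s) + μ * (q * s)  ≤⟨ +-monoˡ-≤ (μ * (q * s)) (*-monoʳ-≤ q (bernoulli s t)) ⟩
  q * suc s ^ t + μ * (q * s)    ≡⟨ cong (_+ μ * (q * s)) (^-distribˡ-+-* (suc s) μ t) ⟨
  suc s ^ (μ + t) + μ * (q * s)  ∎
  where
  open ≤-Reasoning
  q : ℕ
  q = suc s ^ μ
^-above-secant s μ γ | inj₂ γ≤μ with m≤n⇒∃[o]m+o≡n γ≤μ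
...   | t , refl rewrite ^-distribˡ-+-* (suc s) γ t = begin
  a * P + γ * (a * P * s)                  ≤⟨ +-monoˡ-≤ (γ * (a * P * s)) (*-monoʳ-≤ a (reverse-bernoulli s t)) ⟩
  a * (1 + t * (P * s)) + γ * (a * P * s)  ≡⟨ solve 5 (λ a P s t γ → a :* (con 1 :+ t :* (P :* s)) :+ γ :* (a :* P :* s) := a :+ (γ :+ t) :* (a :* P :* s)) refl a P s t γ ⟩
  a + (γ + t) * (a * P * s)                ∎
  where
  open ≤-Reasoning
  a P : ℕ
  a = suc s ^ γ
  P = suc s ^ t

sumℕ-mono-≤ : ∀ {d} {f g : Vector ℕ d} → (∀ i → f i ≤ g i) → sumℕ f ≤ sumℕ g
sumℕ-mono-≤ {zero} _ = z≤n
sumℕ-mono-≤ {suc d} f≤g = +-mono-≤ (f≤g Fin.zero) (sumℕ-mono-≤ (f≤g ∘ Fin.suc))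

sumℕ-const : ∀ d c → sumℕ {d} (λ _ → c) ≡ d * c
sumℕ-const zero c = refl
sumℕ-const (suc d) c = cong (c +_) (sumℕ-const d c)

sum-^-lowerBound : ∀ s {d} μ lam (γ : Vector ℕ d) → lam ≤ d → sumℕ γ ≡ μ * d + lam →
  lam * suc s ^ (μ + 1) + (d ∸ lam) * suc s ^ μ ≤ sumℕ (λ i → suc s ^ γ i)
sum-^-lowerBound s μ lam γ lam≤d Σγ≡ with m≤n⇒∃[o]m+o≡n lam≤d
... | t , refl = +-cancelʳ-≤ ((lam + t) * (μ * r)) _ _ (begin
  lam * suc s ^ (μ + 1) + (lam + t ∸ lam) * q + (lam + t) * (μ * r)
    ≡⟨ cong₂ (λ x y → lam * x + y * q + (lam + t) * (μ * r)) (cong (suc s ^_) (+-comm μ 1)) (m+n∸m≡n lam t) ⟩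
  lam * (suc s * q) + t * q + (lam + t) * (μ * r)
    ≡⟨ solve 5 (λ lam s q t μ → lam :* ((con 1 :+ s) :* q) :+ t :* q :+ (lam :+ t) :* (μ :* (q :* s))
                             := (lam :+ t) :* q :+ (μ :* (lam :+ t) :+ lam) :* (q :* s)) refl lam s q t μ ⟩
  (lam + t) * q + (μ * (lam + t) + lam) * r
    ≡⟨ cong (λ x → (lam + t) * q + x * r) Σγ≡ ⟨
  (lam + t) * q + sumℕ γ * r
    ≡⟨ cong₂ _+_ (sym (sumℕ-const (lam + t) q)) (ℕΣ.*-distribʳ-sum r γ) ⟩
  sumℕ {lam + t} (λ _ → q) + sumℕ (λ i → γ i * r)
    ≡⟨ ℕΣ.∑-distrib-+ (λ _ → q) (λ i → γ i * r) ⟨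
  sumℕ (λ i → q + γ i * r)
    ≤⟨ sumℕ-mono-≤ (λ i → ^-above-secant s μ (γ i)) ⟩
  sumℕ (λ i → suc s ^ γ i + μ * r)
    ≡⟨ ℕΣ.∑-distrib-+ (λ i → suc s ^ γ i) (λ _ → μ * r) ⟩
  sumℕ (λ i → suc s ^ γ i) + sumℕ {lam + t} (λ _ → μ * r)
    ≡⟨ cong (sumℕ (λ i → suc s ^ γ i) +_) (sumℕ-const (lam + t) (μ * r)) ⟩
  sumℕ (λ i → suc s ^ γ i) + (lam + t) * (μ * r) ∎)
  where
  open ≤-Reasoning
  q r : ℕ
  q = suc s ^ μ
  r = q * s

vectorFactorisation-lowerBound : ∀ {p} → Prime p → ∀ {d} e μ lam (α v : Vector ℕ d) →
  lam ≤ d → μ * d + lam ≡ e + sumℕ α → IsVectorFactorisation (p ^ e) d v →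
  lam * p ^ (μ + 1) + (d ∸ lam) * p ^ μ ≤ sumℕ (λ i → p ^ α i * v i)
vectorFactorisation-lowerBound {suc s} p-prime {d} e μ lam α v lam≤d μ-def (_ , Πv≡p^e)
  with prime-power-exponents p-prime e v Πv≡p^e
... | β , v≡ , Σβ≡e = begin
  lam * suc s ^ (μ + 1) + (d ∸ lam) * suc s ^ μ  ≤⟨ sum-^-lowerBound s μ lam (λ i → α i + β i) lam≤d Σγ≡ ⟩
  sumℕ (λ i → suc s ^ (α i + β i))               ≡⟨ ℕΣ.sum-cong-≗ (λ i → ^-distribˡ-+-* (suc s) (α i) (β i)) ⟩
  sumℕ (λ i → suc s ^ α i * suc s ^ β i)         ≡⟨ ℕΣ.sum-cong-≗ (λ i → cong (suc s ^ α i *_) (v≡ i)) ⟨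
  sumℕ (λ i → suc s ^ α i * v i)                 ∎
  where
  open ≤-Reasoning
  Σγ≡ : sumℕ (λ i → α i + β i) ≡ μ * d + lam
  Σγ≡ = begin-equality
    sumℕ (λ i → α i + β i)  ≡⟨ ℕΣ.∑-distrib-+ α β ⟩
    sumℕ α + sumℕ β         ≡⟨ cong (sumℕ α +_) Σβ≡e ⟩
    sumℕ α + e              ≡⟨ +-comm (sumℕ α) e ⟩
    e + sumℕ α              ≡⟨ μ-def ⟨
    μ * d + lam             ∎

toℚ-mkℚ : ∀ n → toℚ n ≡ mkℚ (ℤ.+ n) 0 (coprime-sym (1-coprimeTo n))
toℚ-mkℚ n = ℚP.normalize-coprime (coprime-sym (1-coprimeTo n))

toℚ-+ : ∀ m n → toℚ (m + n) ≡ toℚ m ℚ.+ toℚ n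
toℚ-+ m n = begin
  toℚ (m + n)                                    ≡⟨ ℚP./-cong (cong₂ ℤ._+_ (ℤP.*-identityʳ (ℤ.+ m)) (ℤP.*-identityʳ (ℤ.+ n))) refl ⟨
  (ℤ.+ m ℤ.* ℤ.+ 1 ℤ.+ ℤ.+ n ℤ.* ℤ.+ 1) ℚ./ 1    ≡⟨ cong₂ ℚ._+_ (toℚ-mkℚ m) (toℚ-mkℚ n) ⟨
  toℚ m ℚ.+ toℚ n                                ∎
  where open ≡-Reasoning

toℚ-* : ∀ m n → toℚ (m * n) ≡ toℚ m ℚ.* toℚ n
toℚ-* m n = begin
  toℚ (m * n)                   ≡⟨ ℚP./-cong (ℤP.pos-* m n) refl ⟩
  (ℤ.+ m ℤ.* ℤ.+ n) ℚ./ 1       ≡⟨ cong₂ ℚ._*_ (toℚ-mkℚ m) (toℚ-mkℚ n) ⟨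
  toℚ m ℚ.* toℚ n               ∎
  where open ≡-Reasoning

toℚ-mono-≤ : ∀ {m n} → m ≤ n → toℚ m ℚ.≤ toℚ n
toℚ-mono-≤ {m} {n} m≤n = subst₂ ℚ._≤_ (sym (toℚ-mkℚ m)) (sym (toℚ-mkℚ n))
  (ℚ.*≤* (ℤP.*-monoʳ-≤-nonNeg (ℤ.+ 1) (ℤ.+≤+ m≤n)))

toℚ-sum : ∀ {d} (f : Vector ℕ d) → toℚ (sumℕ f) ≡ sumℚ (λ i → toℚ (f i))
toℚ-sum {zero} f = refl
toℚ-sum {suc d} f = trans (toℚ-+ (head f) (sumℕ (tail f))) (cong (toℚ (head f) ℚ.+_) (toℚ-sum (tail f)))

sumℚ-*-combination-∷ : ∀ {d} (c : Vector ℚ d) w v (ws : WeightedPoints d) →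
  sumℚ (λ i → c i ℚ.* combination ((w , v) ∷ ws) i)
    ≡ w ℚ.* sumℚ (λ i → c i ℚ.* toℚ (v i)) ℚ.+ sumℚ (λ i → c i ℚ.* combination ws i)
sumℚ-*-combination-∷ c w v ws = begin
  sumℚ (λ i → c i ℚ.* (w ℚ.* toℚ (v i) ℚ.+ combination ws i))
    ≡⟨ ℚΣ.sum-cong-≗ (λ i → ℚP.*-distribˡ-+ (c i) _ _) ⟩
  sumℚ (λ i → c i ℚ.* (w ℚ.* toℚ (v i)) ℚ.+ c i ℚ.* combination ws i)
    ≡⟨ ℚΣ.sum-cong-≗ (λ i → cong (ℚ._+ _) (x∙yz≈y∙xz (c i) w _)) ⟩
  sumℚ (λ i → w ℚ.* (c i ℚ.* toℚ (v i)) ℚ.+ c i ℚ.* combination ws i)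
    ≡⟨ ℚΣ.∑-distrib-+ (λ i → w ℚ.* (c i ℚ.* toℚ (v i))) (λ i → c i ℚ.* combination ws i) ⟩
  sumℚ (λ i → w ℚ.* (c i ℚ.* toℚ (v i))) ℚ.+ sumℚ (λ i → c i ℚ.* combination ws i)
    ≡⟨ cong (ℚ._+ _) (ℚΣ.*-distribˡ-sum w (λ i → c i ℚ.* toℚ (v i))) ⟨
  w ℚ.* sumℚ (λ i → c i ℚ.* toℚ (v i)) ℚ.+ sumℚ (λ i → c i ℚ.* combination ws i) ∎
  where open ≡-Reasoning

sumℚ-*-combination-[] : ∀ {d} (c : Vector ℚ d) → sumℚ (λ i → c i ℚ.* combination [] i) ≡ 0ℚ
sumℚ-*-combination-[] {d} c = trans (ℚΣ.sum-cong-≗ (λ i → ℚP.*-zeroʳ (c i))) (ℚΣ.sum-replicate-zero d)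

combination-lowerBound : ∀ {d} (P : Vector ℕ d → Set) (c : Vector ℚ d) (B : ℚ) →
  (∀ v → P v → B ℚ.≤ sumℚ (λ i → c i ℚ.* toℚ (v i))) →
  ∀ ws → All (λ wv → 0ℚ ℚ.≤ proj₁ wv × P (proj₂ wv)) ws →
  sumWeights ws ℚ.* B ℚ.≤ sumℚ (λ i → c i ℚ.* combination ws i)
combination-lowerBound P c B bound [] [] = begin
  0ℚ ℚ.* B                              ≡⟨ ℚP.*-zeroˡ B ⟩
  0ℚ                                    ≡⟨ sumℚ-*-combination-[] c ⟨
  sumℚ (λ i → c i ℚ.* combination [] i) ∎
  where open ℚP.≤-Reasoning
combination-lowerBound P c B bound ((w , v) ∷ ws) ((0≤w , Pv) ∷ all) = begin
  (w ℚ.+ sumWeights ws) ℚ.* B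
    ≡⟨ ℚP.*-distribʳ-+ B w (sumWeights ws) ⟩
  w ℚ.* B ℚ.+ sumWeights ws ℚ.* B
    ≤⟨ ℚP.+-mono-≤ (ℚP.*-monoˡ-≤-nonNeg w {{ℚ.nonNegative 0≤w}} (bound v Pv)) (combination-lowerBound P c B bound ws all) ⟩
  w ℚ.* sumℚ (λ i → c i ℚ.* toℚ (v i)) ℚ.+ sumℚ (λ i → c i ℚ.* combination ws i)
    ≡⟨ sumℚ-*-combination-∷ c w v ws ⟨
  sumℚ (λ i → c i ℚ.* combination ((w , v) ∷ ws) i) ∎
  where open ℚP.≤-Reasoning

proposition3p1 : (p e d lam : ℕ) → Prime p → 2 ≤ e → 2 ≤ d
    → 1 ≤ lam → lam ≤ e ⊓ (d ∸ 1)
    → (α : Vector ℕ d) → InR lam d e α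
    → (μ : ℕ) → μ * d + lam ≡ e + sumℕ α
    → (x : Vector ℚ d) → InP (p ^ e) d x
    → toℚ (lam * p ^ (μ + 1) + (d ∸ lam) * p ^ μ)
        ℚ.≤ sumℚ (λ i → toℚ (p ^ α i) ℚ.* x i)
proposition3p1 p e d lam p-prime _ _ _ lam≤e⊓d-1 α _ μ μ-def x (ws , weighted-factorisations , Σw≡1 , x≡) = begin
  toℚ B                                               ≡⟨ ℚP.*-identityˡ (toℚ B) ⟨
  1ℚ ℚ.* toℚ B                                        ≡⟨ cong (ℚ._* toℚ B) Σw≡1 ⟨
  sumWeights ws ℚ.* toℚ B                             ≤⟨ combination-lowerBound _ c (toℚ B) bound ws weighted-factorisations ⟩
  sumℚ (λ i → c i ℚ.* combination ws i)               ≡⟨ ℚΣ.sum-cong-≗ (λ i → cong (c i ℚ.*_) (x≡ i)) ⟨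
  sumℚ (λ i → c i ℚ.* x i)                            ∎
  where
  open ℚP.≤-Reasoning
  B : ℕ
  B = lam * p ^ (μ + 1) + (d ∸ lam) * p ^ μ
  c : Vector ℚ d
  c i = toℚ (p ^ α i)
  lam≤d : lam ≤ d
  lam≤d = ≤-trans lam≤e⊓d-1 (≤-trans (m⊓n≤n e (d ∸ 1)) (m∸n≤m d 1))
  bound : ∀ v → IsVectorFactorisation (p ^ e) d v → toℚ B ℚ.≤ sumℚ (λ i → c i ℚ.* toℚ (v i))
  bound v v-fact = begin
    toℚ B                                ≤⟨ toℚ-mono-≤ (vectorFactorisation-lowerBound p-prime e μ lam α v lam≤d μ-def v-fact) ⟩
    toℚ (sumℕ (λ i → p ^ α i * v i))     ≡⟨ toℚ-sum (λ i → p ^ α i * v i) ⟩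
    sumℚ (λ i → toℚ (p ^ α i * v i))     ≡⟨ ℚΣ.sum-cong-≗ (λ i → toℚ-* (p ^ α i) (v i)) ⟩
    sumℚ (λ i → c i ℚ.* toℚ (v i))       ∎
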